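{- Let $n, c, q$ be integers with $n > c \geq q \geq 1$. Every collection of directed graphs $G_1, \ldots, G_c$ on a common set of $n$ vertices containing no rainbow $S_{0,q}$ satisfies \[\sum_{i=1}^c e(G_i) \leq (q-1)(n^2-n).\] Moreover, this bound is sharp: for all such $n,c,q$ there is a collection $G_1,\ldots,G_c$ on $n$ common vertices with no rainbow $S_{0,q}$ attaining equality.
   Context: Each $G_i$ is a directed graph without loops or multiple edges on the common vertex set $V$ (for distinct $u,v$, the edges $uv$ and $vu$ may both be present); $e(G_i)$ denotes the number of directed edges of $G_i$. Think of $G_i$ as the edges of color $i$. For integers $p,q\ge 0$, $S_{p,q}$ denotes the orientation of a star on $p+q+1$ vertices whose center has indegree $p$ and outdegree $q$ (all other vertices are leaves). The collection $(G_1,\ldots,G_c)$ contains a rainbow copy of a directed graph $F$ if there exist an injective map $f: V(F)\to V$ and an injective map $\varphi: E(F)\to\{1,\ldots,c\}$ such that for every edge $xy\in E(F)$, the edge $f(x)f(y)$ belongs to $G_{\varphi(xy)}$. -}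

module Defs where

open import Data.Nat using (ℕ; _+_)
open import Data.Bool using (Bool; true; false)
open import Data.Fin using (Fin; _≟_)
open import Data.List using (List; map; allFin)
open import Data.Nat.ListAction using (sum)
open import Data.Product using (Σ; _×_; ∃)
open import Relation.Binary.PropositionalEquality using (_≡_; _≢_)
open import Function.Definitions using (Injective)

-- A collection of c directed graphs (colours) on the vertex set Fin n.
-- G i u v ≡ true  means the directed edge uv is present in G_i.
Collection : ℕ → ℕ → Set
Collection n c = Fin c → Fin n → Fin n → Bool

-- Each G_i has no loops (no multiple edges is automatic: edges are a relation).
Loopless : ∀ {n c} → Collection n c → Set
Loopless {n} {c} G = (i : Fin c) (v : Fin n) → G i v v ≡ false

toℕ𝔹 : Bool → ℕ
toℕ𝔹 true = 1
toℕ𝔹 false = 0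

e : ∀ {n c} → Collection n c → Fin c → ℕ
e {n} G i = sum (map (λ u → sum (map (λ v → toℕ𝔹 (G i u v)) (allFin n))) (allFin n))

totalEdges : ∀ {n c} → Collection n c → ℕ
totalEdges {n} {c} G = sum (map (e G) (allFin c))

-- Rainbow copy of S_{0,q} (out-star with q leaves): a center v, q distinct
-- leaves f j ≠ v (injective f), and q distinct colours φ j (injective φ),
-- with edge v → f j in G_{φ j}.
RainbowOutStar : ∀ {n c} → Collection n c → ℕ → Set
RainbowOutStar {n} {c} G q =
  Σ (Fin n) λ v →
  Σ (Fin q → Fin n) λ f →
  Σ (Fin q → Fin c) λ φ →
    Injective _≡_ _≡_ f × Injective _≡_ _≡_ φ ×
    ((j : Fin q) → f j ≢ v) ×
    ((j : Fin q) → G (φ j) v (f j) ≡ true)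

-- At a fixed vertex v the colour-i out-neighbourhoods N_i are c sets of size at most n − 1, and a
-- rainbow S_{0,q} centred at v is a rainbow matching of size q: distinct colours i_j with distinct
-- elements u_j ∈ N_{i_j}. If no such matching exists then Σ_i |N_i| ≤ (q − 1)(n − 1), by induction
-- on q: when every |N_i| ≤ q − 1 this is just c ≤ n − 1, and otherwise a colour i with |N_i| ≥ q can
-- be discarded, because any rainbow matching of size q − 1 avoiding i extends greedily through N_i.
-- Summing over the n centres gives the bound; q − 1 complete digraphs attain it, since a rainbow
-- S_{0,q} needs q colours.
module Submission where

open import Defs
open import Data.Nat.Properties hiding (_≟_)
open import Algebra.Properties.CommutativeMonoid.Sum +-0-commutativeMonoid
  using (sum; sum-syntax; sum-cong-≗; sum-remove; ∑-comm)
open import Algebra.Properties.CommutativeSemigroup *-commutativeSemigroup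
  using (x∙yz≈y∙xz)
open import Data.Bool using (Bool; true; false; _∧_; not; if_then_else_)
import Data.Bool as Bool
open import Data.Bool.Properties using (∧-zeroʳ; T-∧; T-≡)
open import Data.Fin using (Fin; zero; suc; toℕ; fromℕ<; punchIn; punchOut)
open import Data.Fin.Properties
  using (_≟_; any?; all?; toℕ-injective; toℕ-fromℕ<; injective⇒≤;
         punchIn-injective; punchInᵢ≢i; punchIn-punchOut)
import Data.List as List using (map; tabulate; allFin)
open import Data.List.Properties using (map-tabulate)
import Data.Nat.ListAction as List
open import Data.Nat
  using (ℕ; zero; suc; _+_; _*_; _∸_; _^_; _≤_; _<_; _<ᵇ_; _<?_; z≤n; s≤s)
open import Data.Product using (Σ; _×_; _,_; ∃; proj₁)
open import Data.Vec.Functional using (_∷_; removeAt)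
open import Function using (_∘_; Equivalence)
open import Function.Definitions using (Injective)
open import Relation.Nullary using (¬_; yes; no; ¬?; _×-dec_; contradiction)
open import Relation.Nullary.Decidable using (does; dec-true)
open import Relation.Binary.PropositionalEquality

∑-const : ∀ n x → ∑[ i < n ] x ≡ n * x
∑-const zero    x = refl
∑-const (suc n) x = cong (x +_) (∑-const n x)

∑-zero : ∀ n → ∑[ i < n ] 0 ≡ 0
∑-zero n = trans (∑-const n 0) (*-zeroʳ n)

∑-mono-≤ : ∀ {n} {f g : Fin n → ℕ} → (∀ i → f i ≤ g i) → sum f ≤ sum g
∑-mono-≤ {zero}  f≤g = z≤n
∑-mono-≤ {suc n} f≤g = +-mono-≤ (f≤g zero) (∑-mono-≤ (f≤g ∘ suc))

term≤sum : ∀ {n} (f : Fin n → ℕ) i → f i ≤ sum f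
term≤sum {suc n} f i = ≤-trans (m≤m+n (f i) _) (≤-reflexive (sym (sum-remove {i = i} f)))

listSum-tabulate : ∀ {n} (f : Fin n → ℕ) → List.sum (List.tabulate f) ≡ sum f
listSum-tabulate {zero}  f = refl
listSum-tabulate {suc n} f = cong (f zero +_) (listSum-tabulate (f ∘ suc))

listSum-allFin : ∀ {n} (f : Fin n → ℕ) → List.sum (List.map f (List.allFin n)) ≡ sum f
listSum-allFin f = trans (cong List.sum (map-tabulate (λ i → i) f)) (listSum-tabulate f)

size : ∀ {n} → (Fin n → Bool) → ℕ
size {n} S = ∑[ w < n ] toℕ𝔹 (S w)

size-singleton : ∀ {n} (a : Fin n) → size (λ w → does (a ≟ w)) ≡ 1
size-singleton {suc n} zero    = cong suc (∑-zero n)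
size-singleton {suc n} (suc a) = size-singleton {n} a

size-≤-image : ∀ {n k} (S : Fin n → Bool) (f : Fin k → Fin n) →
  (∀ u → S u ≡ true → ∃ λ j → f j ≡ u) → size S ≤ k
size-≤-image {n} {k} S f covered = begin
  size S                                       ≤⟨ ∑-mono-≤ hits ⟩
  ∑[ u < n ] ∑[ j < k ] toℕ𝔹 (does (f j ≟ u))  ≡⟨ ∑-comm (λ u j → toℕ𝔹 (does (f j ≟ u))) ⟩
  ∑[ j < k ] size (λ u → does (f j ≟ u))       ≡⟨ sum-cong-≗ (size-singleton ∘ f) ⟩
  ∑[ j < k ] 1                                 ≡⟨ trans (∑-const k 1) (*-identityʳ k) ⟩
  k                                            ∎
  where
  open ≤-Reasoning
  hits : ∀ u → toℕ𝔹 (S u) ≤ ∑[ j < k ] toℕ𝔹 (does (f j ≟ u))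
  hits u with S u in Su
  ... | false = z≤n
  ... | true with covered u Su
  ...   | j , refl = ≤-trans (≤-reflexive (cong toℕ𝔹 (sym (dec-true (f j ≟ f j) refl))))
                             (term≤sum (λ j′ → toℕ𝔹 (does (f j′ ≟ f j))) j)

size-≤-pred : ∀ {m} (S : Fin (suc m) → Bool) v → S v ≡ false → size S ≤ m
size-≤-pred S v Sv≡false = size-≤-image S (punchIn v) covered
  where
  covered : ∀ u → S u ≡ true → ∃ λ j → punchIn v j ≡ u
  covered u Su≡true = punchOut v≢u , punchIn-punchOut v≢u
    where
    v≢u : v ≢ u
    v≢u refl = contradiction (trans (sym Su≡true) Sv≡false) λ ()

outside-image : ∀ {n k} (S : Fin n → Bool) (f : Fin k → Fin n) → k < size S →
  ∃ λ u → S u ≡ true × (∀ j → f j ≢ u)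
outside-image S f k<|S| with any? (λ u → (S u Bool.≟ true) ×-dec all? (λ j → ¬? (f j ≟ u)))
... | yes found = found
... | no  none  = contradiction (size-≤-image S f covered) (<⇒≱ k<|S|)
  where
  covered : ∀ u → S u ≡ true → ∃ λ j → f j ≡ u
  covered u Su≡true with any? (λ j → f j ≟ u)
  ... | yes hit  = hit
  ... | no  miss = contradiction (u , Su≡true , λ j fj≡u → miss (j , fj≡u)) none

∷-preserves-injectivity : ∀ {A : Set} {k} {x : A} {f : Fin k → A} →
  (∀ j → f j ≢ x) → Injective _≡_ _≡_ f → Injective _≡_ _≡_ (x ∷ f)
∷-preserves-injectivity x∉f f-inj {zero}  {zero}  _    = refl
∷-preserves-injectivity x∉f f-inj {zero}  {suc j} x≡fj = contradiction (sym x≡fj) (x∉f j)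
∷-preserves-injectivity x∉f f-inj {suc i} {zero}  fi≡x = contradiction fi≡x (x∉f i)
∷-preserves-injectivity x∉f f-inj {suc i} {suc j} fi≡fj = cong suc (f-inj fi≡fj)

RainbowMatching : ∀ {n c} → (Fin c → Fin n → Bool) → ℕ → Set
RainbowMatching {n} {c} N q =
  Σ (Fin q → Fin n) λ f → Σ (Fin q → Fin c) λ φ →
    Injective _≡_ _≡_ f × Injective _≡_ _≡_ φ × (∀ j → N (φ j) (f j) ≡ true)

emptyMatching : ∀ {n c} (N : Fin c → Fin n → Bool) → RainbowMatching N 0
emptyMatching N = (λ ()) , (λ ()) , (λ { {()} }) , (λ { {()} }) , λ ()

extend-matching : ∀ {n c k} (N : Fin (suc c) → Fin n → Bool) i → k < size (N i) →
  RainbowMatching (removeAt N i) k → RainbowMatching N (suc k)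
extend-matching N i k<|Ni| (f , φ , f-inj , φ-inj , f∈N) with outside-image (N i) f k<|Ni|
... | u , u∈Ni , u∉f =
  u ∷ f , i ∷ (punchIn i ∘ φ) ,
  ∷-preserves-injectivity u∉f f-inj ,
  ∷-preserves-injectivity (λ j → punchInᵢ≢i i (φ j)) (φ-inj ∘ punchIn-injective i _ _) ,
  λ { zero → u∈Ni ; (suc j) → f∈N j }

matching-bound : ∀ {n c m} k → c ≤ m → (N : Fin c → Fin n → Bool) → (∀ i → size (N i) ≤ m) →
  ¬ RainbowMatching N (suc k) → ∑[ i < c ] size (N i) ≤ k * m
matching-bound {c = zero}      k _   _ _     _        = z≤n
matching-bound {c = suc c} {m} k c≤m N |N|≤m no-match with any? (λ i → k <? size (N i))
... | no none = begin
  ∑[ i < suc c ] size (N i)  ≤⟨ ∑-mono-≤ (λ i → ≮⇒≥ (λ k<|Ni| → none (i , k<|Ni|))) ⟩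
  ∑[ i < suc c ] k           ≡⟨ ∑-const (suc c) k ⟩
  suc c * k                  ≤⟨ *-monoˡ-≤ k c≤m ⟩
  m * k                      ≡⟨ *-comm m k ⟩
  k * m                      ∎
  where open ≤-Reasoning
... | yes (i , k<|Ni|) with k | (λ M → no-match (extend-matching N i k<|Ni| M))
...   | zero   | no-smaller-match = contradiction (emptyMatching (removeAt N i)) no-smaller-match
...   | suc k  | no-smaller-match = begin
  ∑[ j < suc c ] size (N j)                     ≡⟨ sum-remove {i = i} (size ∘ N) ⟩
  size (N i) + ∑[ j < c ] size (removeAt N i j) ≤⟨ +-mono-≤ (|N|≤m i) rest ⟩
  m + k * m                                     ∎
  where
  open ≤-Reasoning
  rest : ∑[ j < c ] size (removeAt N i j) ≤ k * m
  rest = matching-bound k (≤-trans (n≤1+n c) c≤m) (removeAt N i) (|N|≤m ∘ punchIn i) no-smaller-match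

e≡∑size : ∀ {n c} (G : Collection n c) i → e G i ≡ ∑[ u < n ] size (G i u)
e≡∑size {n} G i =
  trans (listSum-allFin (λ u → List.sum (List.map (toℕ𝔹 ∘ G i u) (List.allFin n))))
        (sum-cong-≗ λ u → listSum-allFin (toℕ𝔹 ∘ G i u))

totalEdges≡∑size : ∀ {n c} (G : Collection n c) →
  totalEdges G ≡ ∑[ i < c ] ∑[ u < n ] size (G i u)
totalEdges≡∑size G = trans (listSum-allFin (e G)) (sum-cong-≗ (e≡∑size G))

outNeighbourhoods : ∀ {n c} → Collection n c → Fin n → Fin c → Fin n → Bool
outNeighbourhoods G v i w = G i v w

matching⇒rainbowOutStar : ∀ {n c q} (G : Collection n c) → Loopless G → ∀ v →
  RainbowMatching (outNeighbourhoods G v) q → RainbowOutStar G q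
matching⇒rainbowOutStar G loopless v (f , φ , f-inj , φ-inj , edges) =
  v , f , φ , f-inj , φ-inj , fj≢v , edges
  where
  fj≢v : ∀ j → f j ≢ v
  fj≢v j refl = contradiction (trans (sym (edges j)) (loopless (φ j) v)) λ ()

totalEdges-bound : ∀ {m c} k (G : Collection (suc m) c) → c ≤ m → Loopless G →
  ¬ RainbowOutStar G (suc k) → totalEdges G ≤ k * (suc m * m)
totalEdges-bound {m} {c} k G c≤m loopless no-star = begin
  totalEdges G                              ≡⟨ totalEdges≡∑size G ⟩
  ∑[ i < c ] ∑[ v < suc m ] size (G i v)    ≡⟨ ∑-comm (λ i v → size (G i v)) ⟩
  ∑[ v < suc m ] ∑[ i < c ] size (G i v)    ≤⟨ ∑-mono-≤ at-vertex ⟩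
  ∑[ v < suc m ] (k * m)                    ≡⟨ ∑-const (suc m) (k * m) ⟩
  suc m * (k * m)                           ≡⟨ x∙yz≈y∙xz (suc m) k m ⟩
  k * (suc m * m)                           ∎
  where
  open ≤-Reasoning
  at-vertex : ∀ v → ∑[ i < c ] size (G i v) ≤ k * m
  at-vertex v = matching-bound k c≤m (outNeighbourhoods G v)
    (λ i → size-≤-pred (G i v) v (loopless i v))
    (no-star ∘ matching⇒rainbowOutStar G loopless v)

injective-not-below : ∀ {c k} (φ : Fin (suc k) → Fin c) → Injective _≡_ _≡_ φ →
  ¬ (∀ j → toℕ (φ j) < k)
injective-not-below {k = k} φ φ-inj below = 1+n≰n (injective⇒≤ ψ-inj)
  where
  ψ : Fin (suc k) → Fin k
  ψ j = fromℕ< (below j)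
  ψ-inj : Injective _≡_ _≡_ ψ
  ψ-inj {a} {b} ψa≡ψb = φ-inj (toℕ-injective (begin
    toℕ (φ a) ≡⟨ toℕ-fromℕ< (below a) ⟨
    toℕ (ψ a) ≡⟨ cong toℕ ψa≡ψb ⟩
    toℕ (ψ b) ≡⟨ toℕ-fromℕ< (below b) ⟩
    toℕ (φ b) ∎))
    where open ≡-Reasoning

completeBelow : ∀ {n c} → ℕ → Collection n c
completeBelow k i u w = (toℕ i <ᵇ k) ∧ not (does (u ≟ w))

completeBelow-loopless : ∀ {n c} k → Loopless (completeBelow {n} {c} k)
completeBelow-loopless k i v rewrite dec-true (v ≟ v) refl = ∧-zeroʳ (toℕ i <ᵇ k)

completeBelow-noRainbowOutStar : ∀ {n c} k → ¬ RainbowOutStar (completeBelow {n} {c} k) (suc k)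
completeBelow-noRainbowOutStar k (v , f , φ , _ , φ-inj , _ , edges) =
  injective-not-below φ φ-inj λ j →
    <ᵇ⇒< (toℕ (φ j)) k (proj₁ (Equivalence.to T-∧ (Equivalence.from T-≡ (edges j))))

size-∁singleton : ∀ {m} (u : Fin (suc m)) → size (λ w → not (does (u ≟ w))) ≡ m
size-∁singleton {m}     zero    = trans (∑-const m 1) (*-identityʳ m)
size-∁singleton {suc m} (suc u) = cong suc (size-∁singleton {m} u)

∑-below : ∀ {c k} x → k ≤ c → ∑[ i < c ] (if toℕ i <ᵇ k then x else 0) ≡ k * x
∑-below {c}     {zero}  x _         = ∑-zero c
∑-below {suc c} {suc k} x (s≤s k≤c) = cong (x +_) (∑-below x k≤c)

completeBelow-edges : ∀ {m c} k → k ≤ c →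
  totalEdges (completeBelow {suc m} {c} k) ≡ k * (suc m * m)
completeBelow-edges {m} {c} k k≤c = begin
  totalEdges G                                      ≡⟨ totalEdges≡∑size G ⟩
  ∑[ i < c ] ∑[ u < suc m ] size (G i u)            ≡⟨ sum-cong-≗ colour-edges ⟩
  ∑[ i < c ] (if toℕ i <ᵇ k then suc m * m else 0)  ≡⟨ ∑-below (suc m * m) k≤c ⟩
  k * (suc m * m)                                   ∎
  where
  open ≡-Reasoning
  G = completeBelow {suc m} {c} k
  colour-edges : ∀ i → ∑[ u < suc m ] size (G i u) ≡ (if toℕ i <ᵇ k then suc m * m else 0)
  colour-edges i with toℕ i <ᵇ k
  ... | true  = trans (sum-cong-≗ {suc m} (size-∁singleton {m})) (∑-const (suc m) m)
  ... | false = trans (sum-cong-≗ {suc m} λ _ → ∑-zero (suc m)) (∑-zero (suc m))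

square∸self : ∀ n → n ^ 2 ∸ n ≡ n * (n ∸ 1)
square∸self n = begin
  n ^ 2 ∸ n      ≡⟨ cong₂ _∸_ (cong (n *_) (*-identityʳ n)) (sym (*-identityʳ n)) ⟩
  n * n ∸ n * 1  ≡⟨ *-distribˡ-∸ n n 1 ⟨
  n * (n ∸ 1)    ∎
  where open ≡-Reasoning

theorem1 : (n c q : ℕ) → c < n → q ≤ c → 1 ≤ q →
    ((G : Collection n c) → Loopless G → ¬ RainbowOutStar G q →
      totalEdges G ≤ (q ∸ 1) * (n ^ 2 ∸ n))
    × Σ (Collection n c) (λ G → Loopless G × ¬ RainbowOutStar G q ×
      (totalEdges G ≡ (q ∸ 1) * (n ^ 2 ∸ n)))
theorem1 (suc m) c (suc k) (s≤s c≤m) q≤c _ rewrite square∸self (suc m) =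
  (λ G → totalEdges-bound k G c≤m) ,
  completeBelow k ,
  completeBelow-loopless k ,
  completeBelow-noRainbowOutStar k ,
  completeBelow-edges {m} k (≤-trans (n≤1+n k) q≤c)
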